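{- Let $n \ge 2$ and let $G$ be any graph. If $I$ is any maximal independent set of $G \times K_n$, then for every $g \in V(G)$, $\left| I \cap \{(g,h) : h \in V(K_n)\} \right| \in \{0,1,n\}$.
   Context: Graphs are finite and simple. The direct product $G\times H$ has vertex set $V(G)\times V(H)$, with $(g_1,h_1)(g_2,h_2)$ an edge iff $g_1g_2\in E(G)$ and $h_1h_2\in E(H)$. $K_n$ is the complete graph on $n$ vertices. -}

module Defs where

open import Data.Nat using (ℕ)
open import Data.Fin using (Fin)
open import Data.Fin.Subset using (Subset; _∈_)
open import Data.Product using (_×_)
open import Relation.Nullary using (¬_)
open import Relation.Binary.PropositionalEquality using (_≡_; _≢_)
open import Level using (0ℓ; suc)

record Graph : Set₁ where
  field
    order : ℕ
    Adj   : Fin order → Fin order → Set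
    sym   : ∀ {x y} → Adj x y → Adj y x
    irrefl : ∀ {x} → ¬ Adj x x
open Graph public

K : ℕ → Graph
K n = record { order = n ; Adj = λ x y → x ≢ y
             ; sym = λ p q → p (Relation.Binary.PropositionalEquality.sym q)
             ; irrefl = λ p → p Relation.Binary.PropositionalEquality.refl }

ProdAdj : (G H : Graph) → (Fin (order G) × Fin (order H)) → (Fin (order G) × Fin (order H)) → Set
ProdAdj G H (g₁ Data.Product., h₁) (g₂ Data.Product., h₂) = Adj G g₁ g₂ × Adj H h₁ h₂

-- A vertex subset of G × H, encoded as: for each g, the subset of V(H)
-- of those h with (g , h) in the set.
VSet : (G H : Graph) → Set
VSet G H = Fin (order G) → Subset (order H)

memP : (G H : Graph) → Fin (order G) × Fin (order H) → VSet G H → Set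
memP G H (g Data.Product., h) I = h ∈ I g

IsIndependent : (G H : Graph) → VSet G H → Set
IsIndependent G H I = ∀ u v → memP G H u I → memP G H v I → ¬ ProdAdj G H u v

_⊆P_ : ∀ {G H} → VSet G H → VSet G H → Set
_⊆P_ {G} {H} I J = ∀ (u : Fin (order G) × Fin (order H)) → memP G H u I → memP G H u J

IsMaximalIndependent : (G H : Graph) → VSet G H → Set
IsMaximalIndependent G H I =
  IsIndependent G H I ×
  (∀ J → IsIndependent G H J → _⊆P_ {G} {H} I J → _⊆P_ {G} {H} J I)

module Submission where

-- If a fibre I g contains two distinct vertices a ≠ b of K n, then every h differs from a or
-- from b, so every (g' , h) with g' ~ g is adjacent to a point of I and all neighbouring
-- fibres are empty. The whole fibre {g} × K n can then be added to I without losing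
-- independence (the fibre itself is independent since G has no loops), so by maximality
-- I g is already full. Otherwise I g has at most one element.

open import Defs
open import Data.Nat using (ℕ; suc; _≤_)
open import Data.Fin using (Fin; _≟_)
open import Data.Fin.Properties using (suc-injective)
open import Data.Fin.Subset using (Subset; ∣_∣; ⊤; _∈_; _∉_; outside; inside)
open import Data.Fin.Subset.Properties using (∈⊤; ⊆⊤; ⊆-antisym; ∣⊤∣≡n)
open import Data.Vec using ([]; _∷_; here; there)
open import Data.Sum using (_⊎_; inj₁; inj₂)
open import Data.Product using (_,_; proj₁)
open import Data.Empty using (⊥-elim)
open import Relation.Nullary using (yes; no)
open import Relation.Binary.PropositionalEquality using (_≡_; _≢_; refl; ≢-sym; cong; trans; subst)
import Relation.Binary.PropositionalEquality as ≡

data EmptySingletonOrPair {n : ℕ} (p : Subset n) : Set where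
  empty     : ∣ p ∣ ≡ 0 → EmptySingletonOrPair p
  singleton : ∀ {a} → a ∈ p → ∣ p ∣ ≡ 1 → EmptySingletonOrPair p
  pair      : ∀ {a b} → a ≢ b → a ∈ p → b ∈ p → EmptySingletonOrPair p

emptySingletonOrPair : ∀ {n} (p : Subset n) → EmptySingletonOrPair p
emptySingletonOrPair []      = empty refl
emptySingletonOrPair (x ∷ p) with emptySingletonOrPair p
... | pair a≢b a∈p b∈p = pair (λ e → a≢b (suc-injective e)) (there a∈p) (there b∈p)
emptySingletonOrPair (outside ∷ p) | empty ∣p∣≡0         = empty ∣p∣≡0
emptySingletonOrPair (inside  ∷ p) | empty ∣p∣≡0         = singleton here (cong suc ∣p∣≡0)
emptySingletonOrPair (outside ∷ p) | singleton a∈p ∣p∣≡1 = singleton (there a∈p) ∣p∣≡1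
emptySingletonOrPair (inside  ∷ p) | singleton a∈p _     = pair (λ ()) here (there a∈p)

module _ {G H : Graph} where

  fillFibre : Fin (order G) → VSet G H → VSet G H
  fillFibre g I g' with g' ≟ g
  ... | yes _ = ⊤
  ... | no  _ = I g'

  fillFibre-full : ∀ g I → fillFibre g I g ≡ ⊤
  fillFibre-full g I with g ≟ g
  ... | yes _  = refl
  ... | no g≢g = ⊥-elim (g≢g refl)

  ⊆P-fillFibre : ∀ g I → _⊆P_ {G} {H} I (fillFibre g I)
  ⊆P-fillFibre g I (g' , h) h∈I with g' ≟ g
  ... | yes _ = ∈⊤
  ... | no  _ = h∈I

  ∈-fillFibre : ∀ g I {g' h} → h ∈ fillFibre g I g' → g' ≡ g ⊎ h ∈ I g'
  ∈-fillFibre g I {g'} h∈J with g' ≟ g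
  ... | yes g'≡g = inj₁ g'≡g
  ... | no  _    = inj₂ h∈J

  fillFibre-independent : ∀ g I → IsIndependent G H I →
    (∀ {g' h} → Adj G g g' → h ∉ I g') → IsIndependent G H (fillFibre g I)
  fillFibre-independent g I ind nbrs (g₁ , h₁) (g₂ , h₂) h₁∈J h₂∈J (g₁~g₂ , h₁~h₂)
    with ∈-fillFibre g I {g₁} h₁∈J | ∈-fillFibre g I {g₂} h₂∈J
  ... | inj₁ refl | inj₁ refl = irrefl G g₁~g₂
  ... | inj₁ refl | inj₂ h₂∈I = nbrs g₁~g₂ h₂∈I
  ... | inj₂ h₁∈I | inj₁ refl = nbrs (Graph.sym G g₁~g₂) h₁∈I
  ... | inj₂ h₁∈I | inj₂ h₂∈I = ind (g₁ , h₁) (g₂ , h₂) h₁∈I h₂∈I (g₁~g₂ , h₁~h₂)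

  maximal⇒fibre-full : ∀ g I → IsMaximalIndependent G H I →
    (∀ {g' h} → Adj G g g' → h ∉ I g') → I g ≡ ⊤
  maximal⇒fibre-full g I (ind , max) nbrs = ⊆-antisym ⊆⊤ λ {h} _ →
    max (fillFibre g I) (fillFibre-independent g I ind nbrs) (⊆P-fillFibre g I)
        (g , h) (subst (h ∈_) (≡.sym (fillFibre-full g I)) ∈⊤)

pair-in-fibre⇒neighbours-empty : ∀ {n} (G : Graph) (I : VSet G (K n)) →
  IsIndependent G (K n) I → ∀ {g a b} → a ≢ b → a ∈ I g → b ∈ I g →
  ∀ {g' h} → Adj G g g' → h ∉ I g'
pair-in-fibre⇒neighbours-empty G I ind {g} {a} {b} a≢b a∈I b∈I {g'} {h} g~g' h∈I
  with h ≟ a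
... | no  h≢a  = ind (g , a) (g' , h) a∈I h∈I (g~g' , ≢-sym h≢a)
... | yes refl = ind (g , b) (g' , h) b∈I h∈I (g~g' , ≢-sym a≢b)

lemma3p1 : (n : ℕ) → 2 ≤ n → (G : Graph) → (I : VSet G (K n)) →
    IsMaximalIndependent G (K n) I →
    (g : Fin (order G)) → ∣ I g ∣ ≡ 0 ⊎ ∣ I g ∣ ≡ 1 ⊎ ∣ I g ∣ ≡ n
lemma3p1 n _ G I maximal g with emptySingletonOrPair (I g)
... | empty ∣Ig∣≡0       = inj₁ ∣Ig∣≡0
... | singleton _ ∣Ig∣≡1 = inj₂ (inj₁ ∣Ig∣≡1)
... | pair a≢b a∈I b∈I   = inj₂ (inj₂ (trans (cong ∣_∣ Ig≡⊤) (∣⊤∣≡n n)))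
  where
  Ig≡⊤ : I g ≡ ⊤
  Ig≡⊤ = maximal⇒fibre-full {G} {K n} g I maximal
           (pair-in-fibre⇒neighbours-empty G I (proj₁ maximal) a≢b a∈I b∈I)
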